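{- The following classes of graphs are not intersectionwise self-$\chi$-guarding: (i) the class of chair-free graphs; (ii) the class of $(K_{1,3}+K_1)$-free graphs.
   Context: All graphs are finite and simple. A chair is the graph on five vertices obtained by identifying one vertex of a $P_2$ with a vertex of degree two of a $P_4$. $G+H$ denotes disjoint union; $K_{1,3}$ is the claw. A graph is $H$-free if it has no induced subgraph isomorphic to $H$. The $k$-fold graph-intersection of a class $\mathcal{A}$ is the class of all graphs $(\bigcap_{i\in[k]}V(G_i),\bigcap_{i\in[k]}E(G_i))$ with $G_1,\dots,G_k\in\mathcal{A}$. A class is $\chi$-bounded if there is a non-decreasing $f:\mathbb{N}\to\mathbb{N}$ with $\chi(G)\le f(\omega(G))$ for all members. A class $\mathcal{A}$ is intersectionwise self-$\chi$-guarding if for every positive integer $k$ the $k$-fold graph-intersection of $\mathcal{A}$ is $\chi$-bounded. -}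

module Defs where

open import Data.Nat using (ℕ; zero; suc; _≤_; _<_)
open import Data.Bool using (Bool; true; false; _∨_)
open import Data.Fin using (Fin; toℕ)
open import Data.Product using (Σ; _×_; ∃; ∃-syntax)
open import Relation.Binary.PropositionalEquality using (_≡_; _≢_)
open import Relation.Nullary using (¬_)
open import Function.Definitions using (Injective)

record Graph : Set where
  field
    V     : ℕ → Bool
    E     : ℕ → ℕ → Bool
    bound : ℕ
    V-fin : ∀ x → V x ≡ true → x < bound
    E-sym : ∀ x y → E x y ≡ E y x
    E-irr : ∀ x → E x x ≡ false
    E-V   : ∀ x y → E x y ≡ true → V x ≡ true
open Graph public

GraphClass : Set₁
GraphClass = Graph → Set

PatternGraph : ℕ → Set
PatternGraph m = Fin m → Fin m → Bool

ContainsInduced : ∀ {m} → Graph → PatternGraph m → Set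
ContainsInduced {m} G H =
  Σ (Fin m → ℕ) λ f → Injective _≡_ _≡_ f
    × (∀ i → V G (f i) ≡ true)
    × (∀ i j → i ≢ j → E G (f i) (f j) ≡ H i j)

Free : ∀ {m} → PatternGraph m → GraphClass
Free H G = ¬ ContainsInduced G H

-- chair: P4 = 0-1-2-3 plus a pendant vertex 4 attached to the degree-two vertex 1
chairEdge : ℕ → ℕ → Bool
chairEdge 0 1 = true
chairEdge 1 2 = true
chairEdge 2 3 = true
chairEdge 1 4 = true
chairEdge _ _ = false

chair : PatternGraph 5
chair i j = chairEdge (toℕ i) (toℕ j) ∨ chairEdge (toℕ j) (toℕ i)

-- K_{1,3} + K_1: centre 0 adjacent to 1,2,3; vertex 4 isolated
clawK1Edge : ℕ → ℕ → Bool
clawK1Edge 0 1 = true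
clawK1Edge 0 2 = true
clawK1Edge 0 3 = true
clawK1Edge _ _ = false

clawPlusK1 : PatternGraph 5
clawPlusK1 i j = clawK1Edge (toℕ i) (toℕ j) ∨ clawK1Edge (toℕ j) (toℕ i)

IsIntersection : ∀ {k} → Graph → (Fin k → Graph) → Set
IsIntersection G Gs =
  (∀ x → (V G x ≡ true → ∀ i → V (Gs i) x ≡ true)
       × ((∀ i → V (Gs i) x ≡ true) → V G x ≡ true))
  × (∀ x y → (E G x y ≡ true → ∀ i → E (Gs i) x y ≡ true)
           × ((∀ i → E (Gs i) x y ≡ true) → E G x y ≡ true))

Intersection : ℕ → GraphClass → GraphClass
Intersection k A G = Σ (Fin k → Graph) λ Gs → (∀ i → A (Gs i)) × IsIntersection G Gs

IsClique : Graph → (m : ℕ) → (Fin m → ℕ) → Set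
IsClique G m f = Injective _≡_ _≡_ f × (∀ i → V G (f i) ≡ true)
               × (∀ i j → i ≢ j → E G (f i) (f j) ≡ true)

HasClique : Graph → ℕ → Set
HasClique G m = Σ (Fin m → ℕ) (IsClique G m)

IsCliqueNumber : Graph → ℕ → Set
IsCliqueNumber G w = HasClique G w × ¬ HasClique G (suc w)

Colourable : Graph → ℕ → Set
Colourable G c = Σ (ℕ → Fin c) λ col → ∀ x y → E G x y ≡ true → col x ≢ col y

NonDecreasing : (ℕ → ℕ) → Set
NonDecreasing f = ∀ m n → m ≤ n → f m ≤ f n

ChiBounded : GraphClass → Set
ChiBounded A = ∃[ f ] NonDecreasing f × (∀ G → A G → ∀ w → IsCliqueNumber G w → Colourable G (f w))

IntersectionwiseSelfChiGuarding : GraphClass → Set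
IntersectionwiseSelfChiGuarding A = ∀ k → 1 ≤ k → ChiBounded (Intersection k A)

{-# OPTIONS --safe #-}
-- The shift graph on n points (pairs i < j, with (i , j) adjacent to (j , l)) is
-- triangle-free, yet any proper c-colouring makes the n sets
-- Sⱼ = { colour of (i , j) : i < j } pairwise distinct (the colour of (i , j) lies in
-- Sⱼ but not in Sᵢ, as every (h , i) is adjacent to (i , j)), so it needs log₂ n
-- colours.  It is the intersection of three graphs on the same pairs: the line graph
-- of Kₙ ("share an end"), which is claw-free since two of three neighbours of a pair
-- must share the same end of it, and the two complete multipartite graphs "different
-- first end" and "different second end", which are (K₁ + K₂)-free.  Both the chair
-- and K₁,₃ + K₁ contain a claw and an induced K₁ + K₂, so all three graphs lie in both
-- classes, and no function of ω = 2 bounds χ of their 3-fold intersections.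
module Submission where

open import Defs
open import Data.Product using (_×_)
open import Relation.Nullary using (¬_; contradiction)

open import Data.Bool using (Bool; true; false)
import Data.Bool.Properties as Bool
open import Data.Empty using (⊥)
open import Data.Fin as Fin using (Fin; toℕ; funToFin; finToFun)
open import Data.Fin.Patterns using (0F; 1F; 2F; 3F; 4F)
open import Data.Fin.Properties using (pigeonhole; finToFun-funToFin; any?; all?; 2↔Bool; toℕ<n; toℕ-fromℕ<)
open import Data.Nat using (ℕ; _+_; _*_; _^_; _/_; _%_; _<_; _<?_; _≟_; z≤n; s≤s; NonZero)
open import Data.Nat.DivMod using (+-distrib-/-∣ʳ; m<n⇒m/n≡0; m*n/n≡m; [m+kn]%n≡m%n; m<n⇒m%n≡m)
open import Data.Nat.Divisibility using (n∣m*n)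
open import Data.Nat.Properties using (<-irrefl; <-trans; <-≤-trans; +-monoˡ-<; *-monoˡ-≤; m≤n+m)
open import Data.Product using (_,_; proj₁; proj₂; ∃-syntax; ∃₂)
open import Data.Sum using (_⊎_; inj₁; inj₂; [_,_]′; swap)
open import Data.Vec using (Vec; []; _∷_; lookup)
open import Function using (_∘_; _on_; Inverse; Injection; mk⇔)
open import Function.Definitions using (Injective)
open import Function.Properties.Inverse using (↔-sym; ↔⇒↣)
open import Relation.Binary.Definitions using (Decidable; Symmetric)
open import Relation.Binary.PropositionalEquality using (_≡_; _≢_; refl; sym; trans; cong; cong₂; subst₂; ≢-sym; module ≡-Reasoning)
open import Relation.Nullary.Decidable using (Dec; yes; no; does; True; toWitness; ¬?; _×-dec_; _⊎-dec_; _→-dec_; dec-true; dec-false; does-⇔; decidable-stable)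

does≡true⇒ : ∀ {A : Set} (a? : Dec A) → does a? ≡ true → A
does≡true⇒ (yes a) _ = a

does≡false⇒ : ∀ {A : Set} (a? : Dec A) → does a? ≡ false → ¬ A
does≡false⇒ (no ¬a) _ = ¬a

IsInducedEmbedding : ∀ {m m′} → PatternGraph m → PatternGraph m′ → (Fin m → Fin m′) → Set
IsInducedEmbedding H H′ σ = (∀ i j → σ i ≡ σ j → i ≡ j) × (∀ i j → i ≢ j → H′ (σ i) (σ j) ≡ H i j)

isInducedEmbedding? : ∀ {m m′} (H : PatternGraph m) (H′ : PatternGraph m′) σ → Dec (IsInducedEmbedding H H′ σ)
isInducedEmbedding? H H′ σ =
  all? (λ i → all? λ j → (σ i Fin.≟ σ j) →-dec (i Fin.≟ j))
  ×-dec all? (λ i → all? λ j → ¬? (i Fin.≟ j) →-dec (H′ (σ i) (σ j) Bool.≟ H i j))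

record _⊑_ {m m′} (H : PatternGraph m) (H′ : PatternGraph m′) : Set where
  constructor embed
  field
    embedding          : Fin m → Fin m′
    isInducedEmbedding : IsInducedEmbedding H H′ embedding

⊑-by-lookup : ∀ {m m′} {H : PatternGraph m} {H′ : PatternGraph m′} (σ : Vec (Fin m′) m) →
              {True (isInducedEmbedding? H H′ (lookup σ))} → H ⊑ H′
⊑-by-lookup σ {isEmbedding} = embed (lookup σ) (toWitness isEmbedding)

ContainsInduced-⊑ : ∀ {m m′} {H : PatternGraph m} {H′ : PatternGraph m′} {G} →
                    H ⊑ H′ → ContainsInduced G H′ → ContainsInduced G H
ContainsInduced-⊑ (embed σ (σ-inj , σ-E)) (f , f-inj , f-V , f-E) =
  f ∘ σ , (λ {i} {j} → σ-inj i j ∘ f-inj) , f-V ∘ σ ,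
  λ i j i≢j → trans (f-E (σ i) (σ j) (i≢j ∘ σ-inj i j)) (σ-E i j i≢j)

Free-⊑ : ∀ {m m′} {H : PatternGraph m} {H′ : PatternGraph m′} → H ⊑ H′ → ∀ G → Free H G → Free H′ G
Free-⊑ H⊑H′ G H-free G⊇H′ = H-free (ContainsInduced-⊑ {G = G} H⊑H′ G⊇H′)

claw : PatternGraph 4
claw 0F          (Fin.suc _) = true
claw (Fin.suc _) 0F          = true
claw _           _           = false

K₁+K₂ : PatternGraph 3
K₁+K₂ 1F 2F = true
K₁+K₂ 2F 1F = true
K₁+K₂ _  _  = false

claw⊑chair : claw ⊑ chair
claw⊑chair = ⊑-by-lookup (1F ∷ 0F ∷ 2F ∷ 4F ∷ [])

K₁+K₂⊑chair : K₁+K₂ ⊑ chair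
K₁+K₂⊑chair = ⊑-by-lookup (0F ∷ 2F ∷ 3F ∷ [])

claw⊑clawPlusK1 : claw ⊑ clawPlusK1
claw⊑clawPlusK1 = ⊑-by-lookup (0F ∷ 1F ∷ 2F ∷ 3F ∷ [])

K₁+K₂⊑clawPlusK1 : K₁+K₂ ⊑ clawPlusK1
K₁+K₂⊑clawPlusK1 = ⊑-by-lookup (4F ∷ 0F ∷ 1F ∷ [])

module RelationGraph (bound : ℕ) {P : ℕ → Set} (P? : ∀ x → Dec (P x))
                     {R : ℕ → ℕ → Set} (R? : Decidable R) (R-sym : Symmetric R) where

  Vertex : ℕ → Set
  Vertex x = x < bound × P x

  Adjacent : ℕ → ℕ → Set
  Adjacent x y = Vertex x × Vertex y × x ≢ y × R x y

  vertex? : ∀ x → Dec (Vertex x)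
  vertex? x = x <? bound ×-dec P? x

  adjacent? : Decidable Adjacent
  adjacent? x y = vertex? x ×-dec vertex? y ×-dec ¬? (x ≟ y) ×-dec R? x y

  adjacent-sym : Symmetric Adjacent
  adjacent-sym (vx , vy , x≢y , r) = vy , vx , ≢-sym x≢y , R-sym r

  graph : Graph
  graph = record
    { V     = λ x → does (vertex? x)
    ; E     = λ x y → does (adjacent? x y)
    ; bound = bound
    ; V-fin = λ x v → proj₁ (does≡true⇒ (vertex? x) v)
    ; E-sym = λ x y → does-⇔ (mk⇔ adjacent-sym adjacent-sym) (adjacent? x y) (adjacent? y x)
    ; E-irr = λ x → dec-false (adjacent? x x) λ (_ , _ , x≢x , _) → x≢x refl
    ; E-V   = λ x y e → dec-true (vertex? x) (proj₁ (does≡true⇒ (adjacent? x y) e))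
    }

  V⇒vertex : ∀ {x} → V graph x ≡ true → Vertex x
  V⇒vertex {x} = does≡true⇒ (vertex? x)

  E⇒adjacent : ∀ {x y} → E graph x y ≡ true → Adjacent x y
  E⇒adjacent {x} {y} = does≡true⇒ (adjacent? x y)

  adjacent⇒E : ∀ {x y} → Adjacent x y → E graph x y ≡ true
  adjacent⇒E {x} {y} = dec-true (adjacent? x y)

  E⇒related : ∀ {x y} → E graph x y ≡ true → R x y
  E⇒related e = let _ , _ , _ , r = E⇒adjacent e in r

  module _ {m} {H : PatternGraph m} where

    embedded-edge : (emb : ContainsInduced graph H) → ∀ i j → i ≢ j → H i j ≡ true →
                    R (proj₁ emb i) (proj₁ emb j)
    embedded-edge (f , _ , _ , f-E) i j i≢j Hij = E⇒related (trans (f-E i j i≢j) Hij)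

    embedded-non-edge : (emb : ContainsInduced graph H) → ∀ i j → i ≢ j → H i j ≡ false →
                        ¬ R (proj₁ emb i) (proj₁ emb j)
    embedded-non-edge (f , f-inj , f-V , f-E) i j i≢j Hij r =
      does≡false⇒ (adjacent? (f i) (f j)) (trans (f-E i j i≢j) Hij)
        (V⇒vertex (f-V i) , V⇒vertex (f-V j) , i≢j ∘ f-inj , r)

module Ends (lo hi : ℕ → ℕ) where

  _∋_ : ℕ → ℕ → Set
  x ∋ k = lo x ≡ k ⊎ hi x ≡ k

  _∋?_ : ∀ x k → Dec (x ∋ k)
  x ∋? k = (lo x ≟ k) ⊎-dec (hi x ≟ k)

  ShareEnd : ℕ → ℕ → Set
  ShareEnd x y = y ∋ lo x ⊎ y ∋ hi x

  shareEnd? : Decidable ShareEnd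
  shareEnd? x y = (y ∋? lo x) ⊎-dec (y ∋? hi x)

  common-end⇒shareEnd : ∀ {x y k} → x ∋ k → y ∋ k → ShareEnd x y
  common-end⇒shareEnd (inj₁ refl) y∋k = inj₁ y∋k
  common-end⇒shareEnd (inj₂ refl) y∋k = inj₂ y∋k

  shareEnd-sym : Symmetric ShareEnd
  shareEnd-sym (inj₁ y∋lo) = common-end⇒shareEnd y∋lo (inj₁ refl)
  shareEnd-sym (inj₂ y∋hi) = common-end⇒shareEnd y∋hi (inj₂ refl)

  shareEnd-pigeonhole : ∀ {c u v w} → ShareEnd c u → ShareEnd c v → ShareEnd c w →
                        ShareEnd u v ⊎ ShareEnd u w ⊎ ShareEnd v w
  shareEnd-pigeonhole (inj₁ u∋k) (inj₁ v∋k) _          = inj₁ (common-end⇒shareEnd u∋k v∋k)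
  shareEnd-pigeonhole (inj₂ u∋k) (inj₂ v∋k) _          = inj₁ (common-end⇒shareEnd u∋k v∋k)
  shareEnd-pigeonhole (inj₁ u∋k) _          (inj₁ w∋k) = inj₂ (inj₁ (common-end⇒shareEnd u∋k w∋k))
  shareEnd-pigeonhole (inj₂ u∋k) _          (inj₂ w∋k) = inj₂ (inj₁ (common-end⇒shareEnd u∋k w∋k))
  shareEnd-pigeonhole _          (inj₁ v∋k) (inj₁ w∋k) = inj₂ (inj₂ (common-end⇒shareEnd v∋k w∋k))
  shareEnd-pigeonhole _          (inj₂ v∋k) (inj₂ w∋k) = inj₂ (inj₂ (common-end⇒shareEnd v∋k w∋k))

  shareEnd-claw-free : ∀ bound {P : ℕ → Set} (P? : ∀ x → Dec (P x)) →
                       Free claw (RelationGraph.graph bound P? shareEnd? shareEnd-sym)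
  shareEnd-claw-free bound P? emb =
    [ embedded-non-edge emb 1F 2F (λ ()) refl
    , [ embedded-non-edge emb 1F 3F (λ ()) refl , embedded-non-edge emb 2F 3F (λ ()) refl ]′ ]′
      (shareEnd-pigeonhole (embedded-edge emb 0F 1F (λ ()) refl)
                           (embedded-edge emb 0F 2F (λ ()) refl)
                           (embedded-edge emb 0F 3F (λ ()) refl))
    where open RelationGraph bound P? shareEnd? shareEnd-sym

differ? : (g : ℕ → ℕ) → Decidable (_≢_ on g)
differ? g x y = ¬? (g x ≟ g y)

differ-K₁+K₂-free : ∀ bound {P : ℕ → Set} (P? : ∀ x → Dec (P x)) (g : ℕ → ℕ) →
                    Free K₁+K₂ (RelationGraph.graph bound P? (differ? g) ≢-sym)
differ-K₁+K₂-free bound P? g emb =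
  embedded-edge emb 1F 2F (λ ()) refl
    (trans (sym (decidable-stable (_ ≟ _) (embedded-non-edge emb 0F 1F (λ ()) refl)))
                (decidable-stable (_ ≟ _) (embedded-non-edge emb 0F 2F (λ ()) refl)))
  where open RelationGraph bound P? (differ? g) ≢-sym

edge⇒clique₂ : ∀ G {x y} → E G x y ≡ true → HasClique G 2
edge⇒clique₂ G {x} {y} xy = f , f-injective , f-V , f-E
  where
  yx : E G y x ≡ true
  yx = trans (E-sym G y x) xy

  f : Fin 2 → ℕ
  f 0F = x
  f 1F = y

  x≢y : x ≢ y
  x≢y refl with () ← trans (sym (E-irr G x)) xy

  f-injective : Injective _≡_ _≡_ f
  f-injective {0F} {0F} _   = refl
  f-injective {0F} {1F} x≡y = contradiction x≡y x≢y
  f-injective {1F} {0F} y≡x = contradiction (sym y≡x) x≢y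
  f-injective {1F} {1F} _   = refl

  f-V : ∀ i → V G (f i) ≡ true
  f-V 0F = E-V G x y xy
  f-V 1F = E-V G y x yx

  f-E : ∀ i j → i ≢ j → E G (f i) (f j) ≡ true
  f-E 0F 0F 0≢0 = contradiction refl 0≢0
  f-E 0F 1F _   = xy
  f-E 1F 0F _   = yx
  f-E 1F 1F 1≢1 = contradiction refl 1≢1

unbounded⇒¬χBounded : ∀ {A : GraphClass} w →
                      (∀ c → ∃[ G ] A G × IsCliqueNumber G w × ¬ Colourable G c) → ¬ ChiBounded A
unbounded⇒¬χBounded w counterexample (f , _ , χ≤f[ω]) =
  let G , G∈A , ω≡w , ¬colourable = counterexample (f w) in ¬colourable (χ≤f[ω] G G∈A w ω≡w)

subsets-pigeonhole : ∀ {c n} → 2 ^ c < n → (S : Fin n → Fin c → Bool) →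
                     ∃₂ λ i j → i Fin.< j × ∀ k → S i k ≡ S j k
subsets-pigeonhole {c} 2^c<n S =
  let i , j , i<j , same = pigeonhole 2^c<n (λ i → funToFin (toFin₂ ∘ S i))
  in i , j , i<j , λ k → Injection.injective (↔⇒↣ (↔-sym 2↔Bool)) (begin
       toFin₂ (S i k)                        ≡⟨ finToFun-funToFin (toFin₂ ∘ S i) k ⟨
       finToFun (funToFin (toFin₂ ∘ S i)) k  ≡⟨ cong (λ code → finToFun code k) same ⟩
       finToFun (funToFin (toFin₂ ∘ S j)) k  ≡⟨ finToFun-funToFin (toFin₂ ∘ S j) k ⟩
       toFin₂ (S j k)                        ∎)
  where
  open ≡-Reasoning
  toFin₂ : Bool → Fin 2
  toFin₂ = Inverse.from 2↔Bool

no-abutting-triangle : ∀ {a₀ b₀ a₁ b₁ a₂ b₂} → a₀ < b₀ → a₁ < b₁ → a₂ < b₂ →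
                       b₀ ≡ a₁ ⊎ b₁ ≡ a₀ → b₀ ≡ a₂ ⊎ b₂ ≡ a₀ → b₁ ≡ a₂ ⊎ b₂ ≡ a₁ → ⊥
no-abutting-triangle _  p₁ _  (inj₁ refl) (inj₁ refl) (inj₁ e) = <-irrefl (sym e) p₁
no-abutting-triangle _  _  p₂ (inj₁ refl) (inj₁ refl) (inj₂ e) = <-irrefl (sym e) p₂
no-abutting-triangle p₀ p₁ p₂ (inj₁ refl) (inj₂ refl) (inj₁ e) = <-irrefl (sym e) (<-trans p₂ (<-trans p₀ p₁))
no-abutting-triangle p₀ _  _  (inj₁ refl) (inj₂ refl) (inj₂ e) = <-irrefl e p₀
no-abutting-triangle p₀ _  _  (inj₂ refl) (inj₁ refl) (inj₁ e) = <-irrefl e p₀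
no-abutting-triangle p₀ p₁ p₂ (inj₂ refl) (inj₁ refl) (inj₂ e) = <-irrefl (sym e) (<-trans p₁ (<-trans p₀ p₂))
no-abutting-triangle _  _  p₂ (inj₂ refl) (inj₂ refl) (inj₁ e) = <-irrefl (sym e) p₂
no-abutting-triangle _  p₁ _  (inj₂ refl) (inj₂ refl) (inj₂ e) = <-irrefl (sym e) p₁

-- A vertex x < n * n stands for the pair (x / n , x % n).

module ShiftGraph (n : ℕ) .{{_ : NonZero n}} where

  lo hi : ℕ → ℕ
  lo x = x / n
  hi x = x % n

  IsPair : ℕ → Set
  IsPair x = lo x < hi x

  isPair? : ∀ x → Dec (IsPair x)
  isPair? x = lo x <? hi x

  Shift : ℕ → ℕ → Set
  Shift x y = hi x ≡ lo y ⊎ hi y ≡ lo x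

  shift? : Decidable Shift
  shift? x y = (hi x ≟ lo y) ⊎-dec (hi y ≟ lo x)

  open Ends lo hi

  module S = RelationGraph (n * n) isPair? shift? swap
  module L = RelationGraph (n * n) isPair? shareEnd? shareEnd-sym
  module D (g : ℕ → ℕ) = RelationGraph (n * n) isPair? (differ? g) ≢-sym

  shiftGraph : Graph
  shiftGraph = S.graph

  layers : Fin 3 → Graph
  layers 0F = L.graph
  layers 1F = D.graph lo
  layers 2F = D.graph hi

  shift⇒shareEnd : ∀ {x y} → Shift x y → ShareEnd x y
  shift⇒shareEnd (inj₁ hx≡ly) = inj₂ (inj₁ (sym hx≡ly))
  shift⇒shareEnd (inj₂ hy≡lx) = inj₁ (inj₂ hy≡lx)

  shift⇒lo-differ : ∀ {x y} → IsPair x → IsPair y → Shift x y → lo x ≢ lo y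
  shift⇒lo-differ px _  (inj₁ hx≡ly) lx≡ly = <-irrefl (trans lx≡ly (sym hx≡ly)) px
  shift⇒lo-differ _  py (inj₂ hy≡lx) lx≡ly = <-irrefl (trans (sym lx≡ly) (sym hy≡lx)) py

  shift⇒hi-differ : ∀ {x y} → IsPair x → IsPair y → Shift x y → hi x ≢ hi y
  shift⇒hi-differ _  py (inj₁ hx≡ly) hx≡hy = <-irrefl (trans (sym hx≡ly) hx≡hy) py
  shift⇒hi-differ px _  (inj₂ hy≡lx) hx≡hy = <-irrefl (sym (trans hx≡hy hy≡lx)) px

  shareEnd×differ⇒shift : ∀ {x y} → ShareEnd x y → lo x ≢ lo y → hi x ≢ hi y → Shift x y
  shareEnd×differ⇒shift (inj₁ (inj₁ ly≡lx)) lo≢ _ = contradiction (sym ly≡lx) lo≢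
  shareEnd×differ⇒shift (inj₁ (inj₂ hy≡lx)) _   _ = inj₂ hy≡lx
  shareEnd×differ⇒shift (inj₂ (inj₁ ly≡hx)) _   _ = inj₁ (sym ly≡hx)
  shareEnd×differ⇒shift (inj₂ (inj₂ hy≡hx)) _ hi≢ = contradiction (sym hy≡hx) hi≢

  shift⇒layers : ∀ {x y} → S.Adjacent x y → ∀ i → E (layers i) x y ≡ true
  shift⇒layers (vx , vy , x≢y , s) 0F = L.adjacent⇒E (vx , vy , x≢y , shift⇒shareEnd s)
  shift⇒layers (vx , vy , x≢y , s) 1F =
    D.adjacent⇒E lo (vx , vy , x≢y , shift⇒lo-differ (proj₂ vx) (proj₂ vy) s)
  shift⇒layers (vx , vy , x≢y , s) 2F =
    D.adjacent⇒E hi (vx , vy , x≢y , shift⇒hi-differ (proj₂ vx) (proj₂ vy) s)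

  layers⇒shift : ∀ {x y} → (∀ i → E (layers i) x y ≡ true) → S.Adjacent x y
  layers⇒shift e =
    let vx , vy , x≢y , share = L.E⇒adjacent (e 0F) in
    vx , vy , x≢y ,
    shareEnd×differ⇒shift share (D.E⇒related lo (e 1F)) (D.E⇒related hi (e 2F))

  shiftGraph-isIntersection : IsIntersection shiftGraph layers
  shiftGraph-isIntersection =
    (λ _ → (λ v → λ { 0F → v ; 1F → v ; 2F → v }) , (λ v → v 0F)) ,
    (λ x y → (λ e → shift⇒layers (S.E⇒adjacent e)) , (λ e → S.adjacent⇒E (layers⇒shift e)))

  shiftGraph∈Intersection₃ : ∀ {A : GraphClass} →
                              (∀ G → Free claw G → A G) → (∀ G → Free K₁+K₂ G → A G) →
                              Intersection 3 A shiftGraph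
  shiftGraph∈Intersection₃ {A} claw-free⇒A K₁+K₂-free⇒A = layers , layers∈A , shiftGraph-isIntersection
    where
    layers∈A : ∀ i → A (layers i)
    layers∈A 0F = claw-free⇒A L.graph (shareEnd-claw-free (n * n) isPair?)
    layers∈A 1F = K₁+K₂-free⇒A (D.graph lo) (differ-K₁+K₂-free (n * n) isPair? lo)
    layers∈A 2F = K₁+K₂-free⇒A (D.graph hi) (differ-K₁+K₂-free (n * n) isPair? hi)

  pair : ℕ → ℕ → ℕ
  pair i j = j + i * n

  lo-pair : ∀ i {j} → j < n → lo (pair i j) ≡ i
  lo-pair i {j} j<n = begin
    (j + i * n) / n    ≡⟨ +-distrib-/-∣ʳ j (n∣m*n i) ⟩
    j / n + i * n / n  ≡⟨ cong₂ _+_ (m<n⇒m/n≡0 j<n) (m*n/n≡m i n) ⟩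
    i                  ∎
    where open ≡-Reasoning

  hi-pair : ∀ i {j} → j < n → hi (pair i j) ≡ j
  hi-pair i {j} j<n = trans ([m+kn]%n≡m%n j i n) (m<n⇒m%n≡m j<n)

  pair-vertex : ∀ {i j} → i < j → j < n → S.Vertex (pair i j)
  pair-vertex {i} {j} i<j j<n =
    <-≤-trans (+-monoˡ-< (i * n) j<n) (*-monoˡ-≤ n (<-trans i<j j<n)) ,
    subst₂ _<_ (sym (lo-pair i j<n)) (sym (hi-pair i j<n)) i<j

  pair-shift : ∀ {i j l} → i < j → j < l → l < n → E shiftGraph (pair i j) (pair j l) ≡ true
  pair-shift {i} {j} {l} i<j j<l l<n =
    S.adjacent⇒E (pair-vertex i<j j<n , pair-vertex j<l l<n , pairs-differ ,
                  inj₁ (trans (hi-pair i j<n) (sym (lo-pair j l<n))))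
    where
    j<n : j < n
    j<n = <-trans j<l l<n

    pairs-differ : pair i j ≢ pair j l
    pairs-differ eq = <-irrefl (trans (sym (lo-pair i j<n)) (trans (cong lo eq) (lo-pair j l<n))) i<j

  shiftGraph-triangle-free : ¬ HasClique shiftGraph 3
  shiftGraph-triangle-free (f , _ , _ , f-E) =
    let (_ , p₀) , (_ , p₁) , _ , s₀₁ = S.E⇒adjacent (f-E 0F 1F (λ ()))
        _        , (_ , p₂) , _ , s₀₂ = S.E⇒adjacent (f-E 0F 2F (λ ()))
        _        , _        , _ , s₁₂ = S.E⇒adjacent (f-E 1F 2F (λ ()))
    in no-abutting-triangle p₀ p₁ p₂ s₀₁ s₀₂ s₁₂

  shiftGraph-cliqueNumber : 2 < n → IsCliqueNumber shiftGraph 2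
  shiftGraph-cliqueNumber 2<n =
    edge⇒clique₂ shiftGraph (pair-shift (s≤s z≤n) (s≤s (s≤s z≤n)) 2<n) , shiftGraph-triangle-free

  shiftGraph-not-colourable : ∀ {c} → 2 ^ c < n → ¬ Colourable shiftGraph c
  shiftGraph-not-colourable {c} 2^c<n (col , proper) =
    let i , j , i<j , same = subsets-pigeonhole 2^c<n (palette ∘ toℕ)
        k = col (pair (toℕ i) (toℕ j))
    in contradiction (trans (sym (palette-∌ i<j (toℕ<n j))) (trans (same k) (palette-∋ i<j))) λ ()
    where
    ColourEndingAt : ℕ → Fin c → Set
    ColourEndingAt j k = ∃[ i ] col (pair (toℕ {j} i) j) ≡ k

    colourEndingAt? : ∀ j k → Dec (ColourEndingAt j k)
    colourEndingAt? j k = any? λ i → col (pair (toℕ i) j) Fin.≟ k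

    palette : ℕ → Fin c → Bool
    palette j k = does (colourEndingAt? j k)

    palette-∋ : ∀ {i j} → i < j → palette j (col (pair i j)) ≡ true
    palette-∋ {i} {j} i<j = dec-true (colourEndingAt? j _)
      (Fin.fromℕ< i<j , cong (λ h → col (pair h j)) (toℕ-fromℕ< i<j))

    palette-∌ : ∀ {i j} → i < j → j < n → palette i (col (pair i j)) ≡ false
    palette-∌ {i} {j} i<j j<n = dec-false (colourEndingAt? i _)
      λ (h , same) → proper _ _ (pair-shift (toℕ<n h) i<j j<n) same

clawFree∪K₁+K₂Free⊆⇒¬selfχGuarding : ∀ {A : GraphClass} →
                               (∀ G → Free claw G → A G) → (∀ G → Free K₁+K₂ G → A G) →
                               ¬ IntersectionwiseSelfChiGuarding A
clawFree∪K₁+K₂Free⊆⇒¬selfχGuarding {A} claw-free⇒A K₁+K₂-free⇒A guarding =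
  unbounded⇒¬χBounded 2 counterexample (guarding 3 (s≤s z≤n))
  where
  counterexample : ∀ c → ∃[ G ] Intersection 3 A G × IsCliqueNumber G 2 × ¬ Colourable G c
  counterexample c =
    shiftGraph , shiftGraph∈Intersection₃ claw-free⇒A K₁+K₂-free⇒A ,
    shiftGraph-cliqueNumber (s≤s (s≤s (s≤s z≤n))) , shiftGraph-not-colourable (s≤s (m≤n+m (2 ^ c) 2))
    where open ShiftGraph (3 + 2 ^ c)

theorem6p3 : ¬ IntersectionwiseSelfChiGuarding (Free chair) × ¬ IntersectionwiseSelfChiGuarding (Free clawPlusK1)
theorem6p3 =
  clawFree∪K₁+K₂Free⊆⇒¬selfχGuarding (Free-⊑ claw⊑chair) (Free-⊑ K₁+K₂⊑chair) ,
  clawFree∪K₁+K₂Free⊆⇒¬selfχGuarding (Free-⊑ claw⊑clawPlusK1) (Free-⊑ K₁+K₂⊑clawPlusK1)
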